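{- Let $N\geq 2$ be an integer and let $R$ be the largest non-negative integer with $\lfloor R^2/4\rfloor<N$. Let $\mathcal{B}_N=\{N-\lfloor j^2/4\rfloor : 1\leq j\leq R-2\}$. Then every primitive gap of the $N\times N$ multiplication table arising between consecutive table elements $x\leq y$ with $N(N-(R-2))\leq x\leq y\leq N^2$ is either $\leq R-3$ or belongs to $\mathcal{B}_N$; and the gaps of the second kind are isolated.
   Context: The $N\times N$ multiplication table is the multiset of the products $ab$ with $1\leq a,b\leq N$. List it in non-decreasing order with multiplicity, $c_1\leq\cdots\leq c_{N^2}$; the primitive gaps are the differences $c_{i+1}-c_i$ between consecutive terms. A gap is isolated if it occurs exactly once in this list of differences (i.e., with multiplicity one). -}

module Defs where

open import Data.Nat using (ℕ; zero; suc; _+_; _*_; _∸_; _≤_; _<_)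
open import Data.Nat.Properties using (≤-decTotalOrder; _≟_)
open import Data.Nat.DivMod using (_/_)
open import Data.List using (List; []; _∷_; map; length; filter; cartesianProductWith; upTo)
open import Data.Product using (_×_; _,_; Σ; ∃-syntax)
open import Relation.Binary.PropositionalEquality using (_≡_)
import Data.List.Sort.InsertionSort

open Data.List.Sort.InsertionSort ≤-decTotalOrder using (sort)

oneTo : ℕ → List ℕ
oneTo N = map suc (upTo N)

products : ℕ → List ℕ
products N = cartesianProductWith _*_ (oneTo N) (oneTo N)

table : ℕ → List ℕ
table N = sort (products N)

consecutive : List ℕ → List (ℕ × ℕ)
consecutive [] = []
consecutive (x ∷ []) = []
consecutive (x ∷ y ∷ xs) = (x , y) ∷ consecutive (y ∷ xs)

gaps : ℕ → List ℕ
gaps N = map (λ p → Data.Product.proj₂ p ∸ Data.Product.proj₁ p) (consecutive (table N))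

gapMultiplicity : ℕ → ℕ → ℕ
gapMultiplicity N g = length (filter (_≟ g) (gaps N))

Isolated : ℕ → ℕ → Set
Isolated N g = gapMultiplicity N g ≡ 1

quarterSq : ℕ → ℕ
quarterSq j = (j * j) / 4

IsLargestR : ℕ → ℕ → Set
IsLargestR N R = quarterSq R < N × (∀ r → quarterSq r < N → r ≤ R)

InB : ℕ → ℕ → ℕ → Set
InB N R g = ∃[ j ] (1 ≤ j × j ≤ R ∸ 2 × g ≡ N ∸ quarterSq j)

-- Write k = R - 2, so that ⌊(k+2)²/4⌋ < N ≤ ⌊(k+3)²/4⌋. An entry c d of the corner N (N - k) ≤ c d has
-- complementary factors i = N - c and j = N - d with i + j ≤ k, and c d = N² - N (i + j) + i j. Moving along the
-- antidiagonal c + d = const towards its middle, the products grow in steps d - c - 1 ≤ k - 1; at the middle the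
-- product is N (N - s) + ⌊s²/4⌋ with s = i + j, and the next entry of the table is the row entry N (N - s + 1),
-- a gap of N - ⌊s²/4⌋ ∈ 𝓑_N. These large gaps are distinct for distinct s, and each occurs only once because every
-- gap below the corner is smaller than N - ⌊k²/4⌋: walking outwards from the middle of the antidiagonal just beyond
-- a point x < N (N - k) reaches a table entry within that distance of x.

module Submission where

open import Data.Empty using (⊥; ⊥-elim)
open import Data.List using (List; []; _∷_; map; length; filter)
open import Data.List.Membership.Propositional using (_∈_)
open import Data.List.Membership.Propositional.Properties
  using (∈-cartesianProductWith⁺; ∈-cartesianProductWith⁻; ∈-map⁺; ∈-map⁻; ∈-upTo⁺; ∈-upTo⁻)
open import Data.List.Properties using (filter-accept; filter-reject)
open import Data.List.Relation.Binary.Permutation.Propositional using (↭-sym)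
open import Data.List.Relation.Binary.Permutation.Propositional.Properties using (∈-resp-↭)
open import Data.List.Relation.Unary.Any using (here; there)
open import Data.List.Relation.Unary.Linked using ([]; [-]; _∷_)
import Data.List.Sort.InsertionSort.Properties as InsertionSort
open import Data.Nat using (ℕ; zero; suc; _+_; _*_; _∸_; _≤_; _<_; _≤′_; ≤′-refl; ≤′-step; z≤n; s≤s; _/_; ⌊_/2⌋; ⌈_/2⌉; _≤?_; _<?_; >-nonZero)
open import Data.Nat.Divisibility using (divides)
open import Data.Nat.DivMod using (/-congˡ; +-distrib-/-∣ʳ; m*n/n≡m)
open import Data.Nat.Properties
open import Data.Nat.Tactic.RingSolver using (solve-∀)
open import Data.Product using (_×_; _,_; proj₁; proj₂; ∃-syntax)
open import Data.Sum using (_⊎_; inj₁; inj₂)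
open import Relation.Binary.Definitions using (tri<; tri≈; tri>)
open import Relation.Binary.PropositionalEquality
open import Relation.Nullary using (yes; no)

open import Defs

open InsertionSort ≤-decTotalOrder using (sort-↭; sort-↗)
open import Data.List.Relation.Unary.Sorted.TotalOrder ≤-totalOrder using (Sorted)

-- Consecutive pairs of a sorted list

Sorted-head≤ : ∀ {a l z} → Sorted (a ∷ l) → z ∈ l → a ≤ z
Sorted-head≤ (a≤b ∷ _) (here refl) = a≤b
Sorted-head≤ (a≤b ∷ s) (there z∈l) = ≤-trans a≤b (Sorted-head≤ s z∈l)

Sorted-tail : ∀ {a l} → Sorted (a ∷ l) → Sorted l
Sorted-tail [-] = []
Sorted-tail (_ ∷ s) = s

consecutive-∈ˡ : ∀ {l x y} → (x , y) ∈ consecutive l → x ∈ l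
consecutive-∈ˡ {_ ∷ _ ∷ _} (here refl) = here refl
consecutive-∈ˡ {_ ∷ _ ∷ _} (there p) = there (consecutive-∈ˡ p)

consecutive-∈ʳ : ∀ {l x y} → (x , y) ∈ consecutive l → y ∈ l
consecutive-∈ʳ {_ ∷ _ ∷ _} (here refl) = there (here refl)
consecutive-∈ʳ {_ ∷ _ ∷ _} (there p) = there (consecutive-∈ʳ p)

consecutive-≤ : ∀ {l x y} → Sorted l → (x , y) ∈ consecutive l → x ≤ y
consecutive-≤ {_ ∷ _ ∷ _} (a≤b ∷ _) (here refl) = a≤b
consecutive-≤ {_ ∷ _ ∷ _} s (there p) = consecutive-≤ (Sorted-tail s) p

consecutive-next : ∀ {l x y z} → Sorted l → (x , y) ∈ consecutive l → z ∈ l → x < z → y ≤ z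
consecutive-next {_ ∷ _ ∷ _} s (here refl) (here refl) x<z = ⊥-elim (<-irrefl refl x<z)
consecutive-next {_ ∷ _ ∷ _} s (here refl) (there (here refl)) x<z = ≤-refl
consecutive-next {_ ∷ _ ∷ _} (_ ∷ s) (here refl) (there (there z∈l)) x<z = Sorted-head≤ s z∈l
consecutive-next {_ ∷ _ ∷ _} s (there p) (here refl) x<z =
  ⊥-elim (<⇒≱ x<z (Sorted-head≤ s (consecutive-∈ˡ p)))
consecutive-next {_ ∷ _ ∷ _} s (there p) (there z∈l) x<z = consecutive-next (Sorted-tail s) p z∈l x<z

consecutive-intro : ∀ {l x y} → Sorted l → x ∈ l → y ∈ l → x < y →
  (∀ {z} → z ∈ l → x < z → y ≤ z) → (x , y) ∈ consecutive l
consecutive-intro {a ∷ []} _ (here refl) (here refl) x<y _ = ⊥-elim (<-irrefl refl x<y)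
consecutive-intro {a ∷ b ∷ _} _ (here refl) (here refl) x<y _ = ⊥-elim (<-irrefl refl x<y)
consecutive-intro {a ∷ b ∷ _} (a≤b ∷ s) (here refl) (there y∈) x<y next with m≤n⇒m<n∨m≡n a≤b
... | inj₁ a<b = here (cong (a ,_) (≤-antisym (next (there (here refl)) a<b) (y∈→b≤y y∈)))
  where
  y∈→b≤y : ∀ {y} → y ∈ b ∷ _ → b ≤ y
  y∈→b≤y (here refl) = ≤-refl
  y∈→b≤y (there y∈) = Sorted-head≤ s y∈
... | inj₂ refl = there (consecutive-intro s (here refl) y∈ x<y (λ z∈ → next (there z∈)))
consecutive-intro {a ∷ b ∷ _} s (there x∈) (here refl) x<y _ = ⊥-elim (<⇒≱ x<y (Sorted-head≤ s x∈))
consecutive-intro {a ∷ b ∷ _} s (there x∈) (there y∈) x<y next =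
  there (consecutive-intro (Sorted-tail s) x∈ y∈ x<y (λ z∈ → next (there z∈)))

difference : ℕ × ℕ → ℕ
difference (x , y) = y ∸ x

count-absent : ∀ ps g → (∀ {x y} → (x , y) ∈ ps → y ∸ x ≡ g → ⊥) →
  length (filter (_≟ g) (map difference ps)) ≡ 0
count-absent [] g absent = refl
count-absent ((x , y) ∷ ps) g absent =
  trans (cong length (filter-reject (_≟ g) (absent (here refl))))
        (count-absent ps g (λ p → absent (there p)))

-- Because x < y and l is sorted, the pair (x , y) occurs only once among the consecutive pairs.
count-unique : ∀ {l x y} → Sorted l → (x , y) ∈ consecutive l → x < y →
  (∀ {x′ y′} → (x′ , y′) ∈ consecutive l → y′ ∸ x′ ≡ y ∸ x → x′ ≡ x) →
  length (filter (_≟ (y ∸ x)) (map difference (consecutive l))) ≡ 1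
count-unique {a ∷ b ∷ l} {x} {y} s p x<y unique with (b ∸ a) ≟ (y ∸ x)
... | yes same = trans (cong length (filter-accept (_≟ (y ∸ x)) same))
  (cong suc (count-absent (consecutive (b ∷ l)) (y ∸ x) λ q e → <⇒≱ a<b (b≤ q e)))
  where
  a≡x : a ≡ x
  a≡x = unique (here refl) same
  a<b : a < b
  a<b = m∸n≢0⇒n<m (λ b∸a≡0 → <⇒≢ (m<n⇒0<n∸m x<y) (trans (sym b∸a≡0) same))
  b≤ : ∀ {x′ y′} → (x′ , y′) ∈ consecutive (b ∷ l) → y′ ∸ x′ ≡ y ∸ x → b ≤ a
  b≤ {x′} q e with consecutive-∈ˡ q
  ... | here refl = ≤-reflexive (trans (unique (there q) e) (sym a≡x))
  ... | there x′∈ = ≤-trans (Sorted-head≤ (Sorted-tail s) x′∈)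
                            (≤-reflexive (trans (unique (there q) e) (sym a≡x)))
... | no differ with p
... | here refl = ⊥-elim (differ refl)
... | there p′ = trans (cong length (filter-reject (_≟ (y ∸ x)) differ))
  (count-unique (Sorted-tail s) p′ x<y (λ q e → unique (there q) e))

-- The multiplication table

table-sorted : ∀ N → Sorted (table N)
table-sorted N = sort-↗ (products N)

∈-oneTo⁺ : ∀ {N a} → 1 ≤ a → a ≤ N → a ∈ oneTo N
∈-oneTo⁺ {a = suc a} _ a≤N = ∈-map⁺ suc (∈-upTo⁺ a≤N)

∈-oneTo⁻ : ∀ {N a} → a ∈ oneTo N → a ≤ N
∈-oneTo⁻ a∈ with ∈-map⁻ suc a∈
... | _ , i∈ , refl = ∈-upTo⁻ i∈

∈-table⁺ : ∀ {N a b} → 1 ≤ a → a ≤ N → 1 ≤ b → b ≤ N → a * b ∈ table N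
∈-table⁺ {N} 1≤a a≤N 1≤b b≤N = ∈-resp-↭ (↭-sym (sort-↭ (products N)))
  (∈-cartesianProductWith⁺ _*_ (∈-oneTo⁺ 1≤a a≤N) (∈-oneTo⁺ 1≤b b≤N))

record Factorisation (N z : ℕ) : Set where
  constructor factorisation
  field
    left right : ℕ
    left-≤ : left ≤ N
    right-≤ : right ≤ N
    product : z ≡ left * right

∈-table⁻ : ∀ {N z} → z ∈ table N → Factorisation N z
∈-table⁻ {N} z∈ with ∈-cartesianProductWith⁻ _*_ (oneTo N) (oneTo N) (∈-resp-↭ (sort-↭ (products N)) z∈)
... | a , b , a∈ , b∈ , z≡ab = factorisation a b (∈-oneTo⁻ a∈) (∈-oneTo⁻ b∈) z≡ab

table-≤ : ∀ {N z} → z ∈ table N → z ≤ N * N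
table-≤ {N} z∈ with ∈-table⁻ {N} z∈
... | factorisation a b a≤N b≤N refl = *-mono-≤ a≤N b≤N

-- Quarter-squares

quarterSq-2+ : ∀ j → quarterSq (2 + j) ≡ quarterSq j + suc j
quarterSq-2+ j = begin
  (2 + j) * (2 + j) / 4       ≡⟨ /-congˡ (square-2+ j) ⟩
  (j * j + suc j * 4) / 4     ≡⟨ +-distrib-/-∣ʳ (j * j) (divides (suc j) refl) ⟩
  j * j / 4 + suc j * 4 / 4   ≡⟨ cong (quarterSq j +_) (m*n/n≡m (suc j) 4) ⟩
  quarterSq j + suc j         ∎
  where
  open ≡-Reasoning
  square-2+ : ∀ j → (2 + j) * (2 + j) ≡ j * j + suc j * 4
  square-2+ = solve-∀

-- (a + b)² = 4ab + (b - a)², with b = a + d.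
*+quarterSq≡quarterSq : ∀ a d → a * (a + d) + quarterSq d ≡ quarterSq (a + (a + d))
*+quarterSq≡quarterSq zero d = refl
*+quarterSq≡quarterSq (suc a) d = begin
  suc a * (suc a + d) + quarterSq d                ≡⟨ step a d (quarterSq d) ⟩
  a * (a + d) + quarterSq d + suc (a + (a + d))    ≡⟨ cong (_+ suc (a + (a + d))) (*+quarterSq≡quarterSq a d) ⟩
  quarterSq (a + (a + d)) + suc (a + (a + d))      ≡⟨ sym (quarterSq-2+ (a + (a + d))) ⟩
  quarterSq (2 + (a + (a + d)))                    ≡⟨ cong (λ n → quarterSq (suc n)) (sym (+-suc a (a + d))) ⟩
  quarterSq (suc a + (suc a + d))                  ∎
  where
  open ≡-Reasoning
  step : ∀ a d t → suc a * (suc a + d) + t ≡ a * (a + d) + t + suc (a + (a + d))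
  step = solve-∀

*+quarterSq-∸ : ∀ {a b} → a ≤ b → a * b + quarterSq (b ∸ a) ≡ quarterSq (a + b)
*+quarterSq-∸ {a} a≤b with m≤n⇒∃[o]m+o≡n a≤b
... | d , refl = trans (cong (λ e → a * (a + d) + quarterSq e) (m+n∸m≡n a d)) (*+quarterSq≡quarterSq a d)

*≤quarterSq-+ : ∀ a b → a * b ≤ quarterSq (a + b)
*≤quarterSq-+ a b with ≤-total a b
... | inj₁ a≤b = ≤-trans (m≤m+n (a * b) _) (≤-reflexive (*+quarterSq-∸ a≤b))
... | inj₂ b≤a = ≤-trans (≤-reflexive (*-comm a b))
  (≤-trans (m≤m+n (b * a) _) (≤-reflexive (trans (*+quarterSq-∸ b≤a) (cong quarterSq (+-comm b a)))))

*≡quarterSq-+ : ∀ {a b} → a ≤ b → b ≤ suc a → a * b ≡ quarterSq (a + b)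
*≡quarterSq-+ {a} {b} a≤b b≤1+a = begin
  a * b                          ≡⟨ sym (+-identityʳ (a * b)) ⟩
  a * b + 0                      ≡⟨ cong (a * b +_) (sym (quarterSq-≤1 (m≤n+o⇒m∸n≤o b a (≤-trans b≤1+a (≤-reflexive (+-comm 1 a)))))) ⟩
  a * b + quarterSq (b ∸ a)      ≡⟨ *+quarterSq-∸ a≤b ⟩
  quarterSq (a + b)              ∎
  where
  open ≡-Reasoning
  quarterSq-≤1 : ∀ {d} → d ≤ 1 → quarterSq d ≡ 0
  quarterSq-≤1 z≤n = refl
  quarterSq-≤1 (s≤s z≤n) = refl

quarterSq-bounds : ∀ j → quarterSq j * 4 ≤ j * j × j * j ≤ quarterSq j * 4 + 1
quarterSq-bounds zero = z≤n , z≤n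
quarterSq-bounds (suc zero) = z≤n , s≤s z≤n
quarterSq-bounds (suc (suc j)) with quarterSq-bounds j
... | lower , upper rewrite quarterSq-2+ j =
  ≤-trans (≤-reflexive (expand₁ (quarterSq j) j)) (≤-trans (+-monoˡ-≤ _ lower) (≤-reflexive (expand₂ j))) ,
  ≤-trans (≤-reflexive (sym (expand₂ j))) (≤-trans (+-monoˡ-≤ _ upper) (≤-reflexive (expand₃ (quarterSq j) j)))
  where
  expand₁ : ∀ t j → (t + suc j) * 4 ≡ t * 4 + suc j * 4
  expand₁ = solve-∀
  expand₂ : ∀ j → j * j + suc j * 4 ≡ suc (suc j) * suc (suc j)
  expand₂ = solve-∀
  expand₃ : ∀ t j → t * 4 + 1 + suc j * 4 ≡ (t + suc j) * 4 + 1
  expand₃ = solve-∀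

quarterSq-≤-suc : ∀ j → quarterSq j ≤ quarterSq (suc j)
quarterSq-≤-suc zero = z≤n
quarterSq-≤-suc (suc zero) = z≤n
quarterSq-≤-suc (suc (suc j)) rewrite quarterSq-2+ j | quarterSq-2+ (suc j) =
  +-mono-≤ (quarterSq-≤-suc j) (n≤1+n (suc j))

quarterSq-<-suc : ∀ {j} → 1 ≤ j → quarterSq j < quarterSq (suc j)
quarterSq-<-suc {suc zero} _ = s≤s z≤n
quarterSq-<-suc {suc (suc j)} _ rewrite quarterSq-2+ j | quarterSq-2+ (suc j) =
  +-mono-≤-< (quarterSq-≤-suc j) (n<1+n (suc j))

quarterSq-mono-≤ : ∀ {i j} → i ≤ j → quarterSq i ≤ quarterSq j
quarterSq-mono-≤ i≤j = go (≤⇒≤′ i≤j)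
  where
  go : ∀ {i j} → i ≤′ j → quarterSq i ≤ quarterSq j
  go ≤′-refl = ≤-refl
  go {j = suc j} (≤′-step i≤′j) = ≤-trans (go i≤′j) (quarterSq-≤-suc j)

quarterSq-mono-< : ∀ {i j} → 1 ≤ i → i < j → quarterSq i < quarterSq j
quarterSq-mono-< 1≤i i<j = <-≤-trans (quarterSq-<-suc 1≤i) (quarterSq-mono-≤ i<j)

quarterSq-cancel-< : ∀ {i j} → quarterSq i < quarterSq j → i < j
quarterSq-cancel-< {i} {j} qi<qj = ≰⇒> (λ j≤i → <⇒≱ qi<qj (quarterSq-mono-≤ j≤i))

quarterSq-injective : ∀ {i j} → 1 ≤ i → 1 ≤ j → quarterSq i ≡ quarterSq j → i ≡ j
quarterSq-injective {i} {j} 1≤i 1≤j qi≡qj with <-cmp i j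
... | tri< i<j _ _ = ⊥-elim (<-irrefl qi≡qj (quarterSq-mono-< 1≤i i<j))
... | tri≈ _ i≡j _ = i≡j
... | tri> _ _ j<i = ⊥-elim (<-irrefl (sym qi≡qj) (quarterSq-mono-< 1≤j j<i))

⌈n/2⌉≤1+⌊n/2⌋ : ∀ n → ⌈ n /2⌉ ≤ suc ⌊ n /2⌋
⌈n/2⌉≤1+⌊n/2⌋ zero = z≤n
⌈n/2⌉≤1+⌊n/2⌋ (suc zero) = s≤s z≤n
⌈n/2⌉≤1+⌊n/2⌋ (suc (suc n)) = s≤s (⌈n/2⌉≤1+⌊n/2⌋ n)

⌊n/2⌋*⌈n/2⌉≡quarterSq : ∀ n → ⌊ n /2⌋ * ⌈ n /2⌉ ≡ quarterSq n
⌊n/2⌋*⌈n/2⌉≡quarterSq n =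
  trans (*≡quarterSq-+ (⌊n/2⌋≤⌈n/2⌉ n) (⌈n/2⌉≤1+⌊n/2⌋ n)) (cong quarterSq (⌊n/2⌋+⌈n/2⌉≡n n))

quarterSq-root : ∀ x → ∃[ s ] (quarterSq s ≤ x × x < quarterSq (suc s))
quarterSq-root zero = 1 , z≤n , s≤s z≤n
quarterSq-root (suc x) with quarterSq-root x
... | s , lower , upper with suc x <? quarterSq (suc s)
...   | yes below = s , m≤n⇒m≤1+n lower , below
...   | no notBelow = suc s , ≮⇒≥ notBelow , <-≤-trans (s≤s upper) (quarterSq-<-suc {suc s} (s≤s z≤n))

-- Antidiagonals of the table

antidiagonal-mono : ∀ {a b a′ b′} → a ≤ b → a + b ≡ a′ + b′ → b ≤ b′ → a′ * b′ ≤ a * b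
antidiagonal-mono {a} {b} {a′} {b′} a≤b sum b≤b′ = +-cancelʳ-≤ (quarterSq (b ∸ a)) (a′ * b′) (a * b) (begin
  a′ * b′ + quarterSq (b ∸ a)    ≤⟨ +-monoʳ-≤ (a′ * b′) (quarterSq-mono-≤ (∸-mono b≤b′ a′≤a)) ⟩
  a′ * b′ + quarterSq (b′ ∸ a′)  ≡⟨ *+quarterSq-∸ a′≤b′ ⟩
  quarterSq (a′ + b′)            ≡⟨ cong quarterSq (sym sum) ⟩
  quarterSq (a + b)              ≡⟨ sym (*+quarterSq-∸ a≤b) ⟩
  a * b + quarterSq (b ∸ a)      ∎)
  where
  open ≤-Reasoning
  a′≤a : a′ ≤ a
  a′≤a = +-cancelʳ-≤ b a′ a (≤-trans (+-monoʳ-≤ a′ b≤b′) (≤-reflexive (sym sum)))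
  a′≤b′ : a′ ≤ b′
  a′≤b′ = ≤-trans a′≤a (≤-trans a≤b b≤b′)

outward-walk : ∀ {x} c b → x < suc c * b →
  ∃[ c′ ] ∃[ b′ ] (c′ ≤ c × c′ + b′ ≡ c + b × c′ * suc b′ ≤ x × x < suc c′ * b′)
outward-walk zero b x<b = 0 , b , z≤n , refl , z≤n , x<b
outward-walk {x} (suc c) b x<cb with suc c * suc b ≤? x
... | yes stop = suc c , b , ≤-refl , refl , stop , x<cb
... | no continue with outward-walk c (suc b) (≰⇒> continue)
...   | c′ , b′ , c′≤c , sum , stop , x<c′b′ = c′ , b′ , m≤n⇒m≤1+n c′≤c , trans sum (+-suc c b) , stop , x<c′b′

record Crossing (x T : ℕ) : Set where
  field
    c b : ℕ
    1+c≤b : suc c ≤ b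
    on-antidiagonal : suc c + b ≡ T
    outer-≤ : c * suc b ≤ x
    inner-> : x < suc c * b

antidiagonal-crossing : ∀ {x} T → x < quarterSq T → Crossing x T
antidiagonal-crossing {x} T x<qT with ⌊ T /2⌋ | ⌊n/2⌋≤⌈n/2⌉ T | ⌊n/2⌋*⌈n/2⌉≡quarterSq T | ⌊n/2⌋+⌈n/2⌉≡n T
... | zero | _ | qT≡0 | _ = ⊥-elim (<⇒≱ x<qT (≤-trans (≤-reflexive (sym qT≡0)) z≤n))
... | suc c | 1+c≤⌈T/2⌉ | middle | halves with outward-walk c ⌈ T /2⌉ (subst (x <_) (sym middle) x<qT)
...   | c′ , b′ , c′≤c , sum , outer , inner = record
  { c = c′ ; b = b′
  ; 1+c≤b = ≤-trans (s≤s c′≤c) (≤-trans 1+c≤⌈T/2⌉ ⌈T/2⌉≤b′)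
  ; on-antidiagonal = trans (cong suc sum) halves
  ; outer-≤ = outer ; inner-> = inner }
  where
  ⌈T/2⌉≤b′ : ⌈ T /2⌉ ≤ b′
  ⌈T/2⌉≤b′ = +-cancelˡ-≤ c′ _ _ (≤-trans (+-monoˡ-≤ ⌈ T /2⌉ c′≤c) (≤-reflexive (sym sum)))

crossing-gap : ∀ {c b x} → c * suc b ≤ x → suc c * b + c ≤ x + b
crossing-gap {c} {b} outer = ≤-trans (≤-reflexive (swap c b)) (+-monoˡ-≤ b outer)
  where
  swap : ∀ c b → suc c * b + c ≡ c * suc b + b
  swap = solve-∀

-- 4 a (a + v) = (2a + v)² - v² and 4 ⌊S²/4⌋ ≥ S² - 1.
antidiagonal-spread : ∀ {a v S} → a + (a + v) ≡ suc S → quarterSq S < a * (a + v) → v * v + 2 ≤ S + S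
antidiagonal-spread {a} {v} {S} sum qS<ab = +-cancelʳ-≤ (S * S + 1) (v * v + 2) (S + S) (begin
  v * v + 2 + (S * S + 1)             ≡⟨ shuffle (v * v) (S * S) ⟩
  v * v + (S * S + 3)                 ≤⟨ +-monoʳ-≤ (v * v) (+-monoˡ-≤ 3 (proj₂ (quarterSq-bounds S))) ⟩
  v * v + (quarterSq S * 4 + 1 + 3)   ≡⟨ cong (v * v +_) (four-succ (quarterSq S)) ⟩
  v * v + suc (quarterSq S) * 4       ≤⟨ +-monoʳ-≤ (v * v) (*-monoˡ-≤ 4 qS<ab) ⟩
  v * v + a * (a + v) * 4             ≡⟨ square-sum a v ⟩
  (a + (a + v)) * (a + (a + v))       ≡⟨ cong₂ _*_ sum sum ⟩
  suc S * suc S                       ≡⟨ square-suc S ⟩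
  S + S + (S * S + 1)                 ∎)
  where
  open ≤-Reasoning
  shuffle : ∀ u w → u + 2 + (w + 1) ≡ u + (w + 3)
  shuffle = solve-∀
  four-succ : ∀ t → t * 4 + 1 + 3 ≡ suc t * 4
  four-succ = solve-∀
  square-sum : ∀ a v → v * v + a * (a + v) * 4 ≡ (a + (a + v)) * (a + (a + v))
  square-sum = solve-∀
  square-suc : ∀ s → suc s * suc s ≡ s + s + (s * s + 1)
  square-suc = solve-∀

spread-≤ : ∀ {v S p k} → v * v + 2 ≤ S + S → S ≤ p + p + k + 1 → p + k + 2 ≤ quarterSq (3 + k) → v ≤ suc k
spread-≤ {v} {S} {p} {k} spread S≤ N≤ = ≮⇒≥ λ k+1<v →
  <⇒≱ (s≤s (s≤s (s≤s z≤n))) (+-cancelˡ-≤ ((3 + k) * (3 + k) + 2 * k) 5 2 (squeeze k+1<v))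
  where
  open ≤-Reasoning
  squeeze : suc k < v → (3 + k) * (3 + k) + 2 * k + 5 ≤ (3 + k) * (3 + k) + 2 * k + 2
  squeeze k+1<v = begin
    (3 + k) * (3 + k) + 2 * k + 5        ≡⟨ expand₁ k ⟩
    (2 + k) * (2 + k) + 2 + (k * 4 + 8)  ≤⟨ +-monoˡ-≤ (k * 4 + 8) (+-monoˡ-≤ 2 (*-mono-≤ k+1<v k+1<v)) ⟩
    v * v + 2 + (k * 4 + 8)              ≤⟨ +-monoˡ-≤ (k * 4 + 8) (≤-trans spread (+-mono-≤ S≤ S≤)) ⟩
    (p + p + k + 1) + (p + p + k + 1) + (k * 4 + 8) ≡⟨ expand₂ p k ⟩
    (p + k + 2) * 4 + 2 * k + 2          ≤⟨ +-monoˡ-≤ 2 (+-monoˡ-≤ (2 * k) (*-monoˡ-≤ 4 N≤)) ⟩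
    quarterSq (3 + k) * 4 + 2 * k + 2    ≤⟨ +-monoˡ-≤ 2 (+-monoˡ-≤ (2 * k) (proj₁ (quarterSq-bounds (3 + k)))) ⟩
    (3 + k) * (3 + k) + 2 * k + 2        ∎
    where
    expand₁ : ∀ k → (3 + k) * (3 + k) + 2 * k + 5 ≡ (2 + k) * (2 + k) + 2 + (k * 4 + 8)
    expand₁ = solve-∀
    expand₂ : ∀ p k → (p + p + k + 1) + (p + p + k + 1) + (k * 4 + 8) ≡ (p + k + 2) * 4 + 2 * k + 2
    expand₂ = solve-∀

spread+quarterSq-≤ : ∀ {v S p k} → 1 ≤ k → v * v + 2 ≤ S + S → S ≤ p + p + k + 1 → quarterSq k ≤ p →
  v + quarterSq k ≤ p + k
spread+quarterSq-≤ {v} {S} {p} {k} 1≤k spread S≤ qk≤p with v ≤? k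
... | yes v≤k = ≤-trans (+-mono-≤ v≤k qk≤p) (≤-reflexive (+-comm k p))
... | no v≰k = ≤-pred (*-cancelʳ-< 4 (v + quarterSq k) (suc (p + k)) (begin-strict
  (v + quarterSq k) * 4                 ≡⟨ *-distribʳ-+ 4 v (quarterSq k) ⟩
  v * 4 + quarterSq k * 4               ≤⟨ +-monoʳ-≤ (v * 4) (proj₁ (quarterSq-bounds k)) ⟩
  v * 4 + k * k                         ≤⟨ square-gap 1≤k (≰⇒> v≰k) ⟩
  v * v + 2 + (2 * k + 1)               ≤⟨ +-monoˡ-≤ (2 * k + 1) (≤-trans spread (+-mono-≤ S≤ S≤)) ⟩
  (p + p + k + 1) + (p + p + k + 1) + (2 * k + 1) <⟨ ≤-reflexive (expand p k) ⟩
  suc (p + k) * 4                       ∎))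
  where
  open ≤-Reasoning
  expand : ∀ p k → suc ((p + p + k + 1) + (p + p + k + 1) + (2 * k + 1)) ≡ suc (p + k) * 4
  expand = solve-∀
  -- (v - 2)² ≥ (k - 1)² once v > k ≥ 1.
  square-gap : ∀ {v k} → 1 ≤ k → k < v → v * 4 + k * k ≤ v * v + 2 + (2 * k + 1)
  square-gap {v} {suc k′} _ k<v with m≤n⇒∃[o]m+o≡n k<v
  ... | f , refl = ≤-trans (m≤m+n _ (f * (f + 2 * k′))) (≤-reflexive (expand′ k′ f))
    where
    expand′ : ∀ k′ f → (2 + k′ + f) * 4 + suc k′ * suc k′ + f * (f + 2 * k′) ≡ (2 + k′ + f) * (2 + k′ + f) + 2 + (2 * suc k′ + 1)
    expand′ = solve-∀

-- Gaps below the corner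

ShortStep : ℕ → ℕ → ℕ → Set
ShortStep N k x = ∃[ z ] (z ∈ table N × x < z × z + quarterSq k < x + N)

-- On N P ≤ x < N (P + 1) use the antidiagonal through (P , N), and beyond its middle the row entry N (P + 1).
short-step-in-block : ∀ {N k P x} → 1 ≤ k → quarterSq k ≤ P → P + k < N →
  N * P ≤ x → x < N * suc P → ShortStep N k x
short-step-in-block {N} {k} {P} {x} 1≤k qk≤P P+k<N NP≤x x<N[1+P] with x <? quarterSq (P + N)
... | yes x<q = suc c * b , ∈-table⁺ (s≤s z≤n) (≤-trans 1+c≤b (<⇒≤ b<N)) (≤-trans (s≤s z≤n) 1+c≤b) (<⇒≤ b<N)
                          , inner-> , bound
  where
  open Crossing (antidiagonal-crossing (P + N) x<q)
  open ≤-Reasoning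
  b<N : b < N
  b<N = ≰⇒> λ N≤b → <⇒≱ inner->
    (≤-trans (antidiagonal-mono (≤-trans (m≤m+n P k) (<⇒≤ P+k<N)) (sym on-antidiagonal) N≤b) (≤-trans (≤-reflexive (*-comm P N)) NP≤x))
  P≤c : P ≤ c
  P≤c = ≤-pred (+-cancelʳ-< N P (suc c) (begin-strict
    P + N          ≡⟨ sym on-antidiagonal ⟩
    suc c + b      <⟨ +-monoʳ-< (suc c) b<N ⟩
    suc c + N      ∎))
  bound : suc c * b + quarterSq k < x + N
  bound = begin-strict
    suc c * b + quarterSq k   ≤⟨ +-monoʳ-≤ (suc c * b) (≤-trans qk≤P P≤c) ⟩
    suc c * b + c             ≤⟨ crossing-gap outer-≤ ⟩
    x + b                     <⟨ +-monoʳ-< x b<N ⟩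
    x + N                     ∎
... | no x≮q = N * suc P , ∈-table⁺ (≤-trans (s≤s z≤n) P<N) ≤-refl (s≤s z≤n) P<N , x<N[1+P] , bound
  where
  open ≤-Reasoning
  P<N : P < N
  P<N = ≤-<-trans (m≤m+n P k) P+k<N
  P≤N : P ≤ N
  P≤N = <⇒≤ P<N
  k<N∸P : k < N ∸ P
  k<N∸P = m+n≤o⇒m≤o∸n (suc k) (≤-trans (≤-reflexive (cong suc (+-comm k P))) P+k<N)
  bound : N * suc P + quarterSq k < x + N
  bound = begin-strict
    N * suc P + quarterSq k          ≡⟨ cong (_+ quarterSq k) (*-suc N P) ⟩
    N + N * P + quarterSq k          ≡⟨ +-assoc N (N * P) (quarterSq k) ⟩
    N + (N * P + quarterSq k)        <⟨ +-monoʳ-< N (+-monoʳ-< (N * P) (quarterSq-mono-< 1≤k k<N∸P)) ⟩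
    N + (N * P + quarterSq (N ∸ P))  ≡⟨ cong (λ m → N + (m + quarterSq (N ∸ P))) (*-comm N P) ⟩
    N + (P * N + quarterSq (N ∸ P))  ≡⟨ cong (N +_) (*+quarterSq-∸ P≤N) ⟩
    N + quarterSq (P + N)            ≤⟨ +-monoʳ-≤ N (≮⇒≥ x≮q) ⟩
    N + x                            ≡⟨ +-comm N x ⟩
    x + N                            ∎

-- Cross the antidiagonal S + 1 with ⌊S²/4⌋ ≤ x < ⌊(S+1)²/4⌋: near its middle, neighbouring products are close.
short-step-deep : ∀ {N k p x} → 1 ≤ k → p + (2 + k) ≡ N → quarterSq k ≤ p → N ≤ quarterSq (3 + k) →
  x < N * p → ShortStep N k x
short-step-deep {N} {k} {p} {x} 1≤k p+2+k≡N qk≤p N≤q x<Np with quarterSq-root x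
... | S , qS≤x , x<q = suc c * b , ∈-table⁺ (s≤s z≤n) (≤-trans 1+c≤b (<⇒≤ b<N)) (≤-trans (s≤s z≤n) 1+c≤b) (<⇒≤ b<N)
                     , inner-> , bound
  where
  open Crossing (antidiagonal-crossing (suc S) x<q)
  open ≤-Reasoning
  v : ℕ
  v = b ∸ suc c
  b≡1+c+v : suc c + v ≡ b
  b≡1+c+v = m+[n∸m]≡n 1+c≤b
  S<p+N : S < p + N
  S<p+N = quarterSq-cancel-< (begin-strict
    quarterSq S                    ≤⟨ qS≤x ⟩
    x                              <⟨ x<Np ⟩
    N * p                          ≡⟨ *-comm N p ⟩
    p * N                          ≤⟨ m≤m+n (p * N) _ ⟩
    p * N + quarterSq (N ∸ p)      ≡⟨ *+quarterSq-∸ (≤-trans (m≤m+n p (2 + k)) (≤-reflexive p+2+k≡N)) ⟩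
    quarterSq (p + N)              ∎)
  S≤ : S ≤ p + p + k + 1
  S≤ = ≤-pred (≤-trans S<p+N (≤-reflexive (trans (cong (p +_) (sym p+2+k≡N)) (rearrange p k))))
    where
    rearrange : ∀ p k → p + (p + (2 + k)) ≡ suc (p + p + k + 1)
    rearrange = solve-∀
  spread : v * v + 2 ≤ S + S
  spread = antidiagonal-spread (trans (cong (suc c +_) b≡1+c+v) on-antidiagonal)
    (≤-<-trans qS≤x (subst (λ m → x < suc c * m) (sym b≡1+c+v) inner->))
  v≤1+k : v ≤ suc k
  v≤1+k = spread-≤ spread S≤ (≤-trans (≤-reflexive (rearrange p k)) (≤-trans (≤-reflexive p+2+k≡N) N≤q))
    where
    rearrange : ∀ p k → p + k + 2 ≡ p + (2 + k)
    rearrange = solve-∀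
  b<N : b < N
  b<N = ≰⇒> λ N≤b → <⇒≱ (begin-strict
    b + b                    ≡⟨ cong (_+ b) (sym b≡1+c+v) ⟩
    suc c + v + b            ≡⟨ rearrange (suc c) v b ⟩
    suc c + b + v            ≡⟨ cong (_+ v) on-antidiagonal ⟩
    suc S + v                ≤⟨ +-mono-≤ (s≤s S≤) v≤1+k ⟩
    suc (p + p + k + 1) + suc k  <⟨ ≤-reflexive (rearrange′ p k) ⟩
    (p + (2 + k)) + (p + (2 + k)) ≡⟨ cong₂ _+_ p+2+k≡N p+2+k≡N ⟩
    N + N                    ∎) (+-mono-≤ N≤b N≤b)
    where
    rearrange : ∀ a v b → a + v + b ≡ a + b + v
    rearrange = solve-∀
    rearrange′ : ∀ p k → suc (suc (p + p + k + 1) + suc k) ≡ (p + (2 + k)) + (p + (2 + k))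
    rearrange′ = solve-∀
  bound : suc c * b + quarterSq k < x + N
  bound = +-cancelʳ-< c _ _ (begin-strict
    suc c * b + quarterSq k + c      ≡⟨ +-comm-inner (suc c * b) (quarterSq k) c ⟩
    suc c * b + c + quarterSq k      ≤⟨ +-monoˡ-≤ (quarterSq k) (crossing-gap outer-≤) ⟩
    x + b + quarterSq k              ≡⟨ cong (λ m → x + m + quarterSq k) (sym b≡1+c+v) ⟩
    x + (suc c + v) + quarterSq k    ≡⟨ rearrange x c v (quarterSq k) ⟩
    x + suc (v + quarterSq k) + c    ≤⟨ +-monoˡ-≤ c (+-monoʳ-≤ x (s≤s (spread+quarterSq-≤ 1≤k spread S≤ qk≤p))) ⟩
    x + suc (p + k) + c              <⟨ +-monoˡ-< c (+-monoʳ-< x (≤-reflexive (rearrange′ p k))) ⟩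
    x + (p + (2 + k)) + c            ≡⟨ cong (λ m → x + m + c) p+2+k≡N ⟩
    x + N + c                        ∎)
    where
    +-comm-inner : ∀ a b c → a + b + c ≡ a + c + b
    +-comm-inner = solve-∀
    rearrange : ∀ x c v t → x + (suc c + v) + t ≡ x + suc (v + t) + c
    rearrange = solve-∀
    rearrange′ : ∀ p k → suc (suc (p + k)) ≡ p + (2 + k)
    rearrange′ = solve-∀

corner-room : ∀ {N k} → quarterSq (2 + k) < N → quarterSq k + (2 + k) ≤ N
corner-room {N} {k} below = ≤-trans (≤-reflexive (trans (+-suc (quarterSq k) (suc k)) (cong suc (sym (quarterSq-2+ k))))) below

short-step-below-corner : ∀ {N k x} → 1 ≤ k → quarterSq (2 + k) < N → N ≤ quarterSq (3 + k) →
  x < N * (N ∸ k) → ShortStep N k x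
short-step-below-corner {N} {k} {x} 1≤k below above x<corner =
  split (N ∸ (2 + k)) (m∸n+n≡m (≤-trans (m≤n+m (2 + k) (quarterSq k)) room))
        (m+n≤o⇒m≤o∸n (quarterSq k) room)
  where
  room : quarterSq k + (2 + k) ≤ N
  room = corner-room below
  split : ∀ p → p + (2 + k) ≡ N → quarterSq k ≤ p → ShortStep N k x
  split p p+2+k≡N qk≤p with x <? N * p | x <? N * suc p
  ... | yes x<Np | _ = short-step-deep 1≤k p+2+k≡N qk≤p above x<Np
  ... | no x≮Np | yes x<N[1+p] = short-step-in-block 1≤k qk≤p p+k<N (≮⇒≥ x≮Np) x<N[1+p]
    where
    p+k<N : p + k < N
    p+k<N = ≤-trans (≤-reflexive (sym (+-suc p k))) (≤-trans (+-monoʳ-≤ p (n≤1+n (suc k))) (≤-reflexive p+2+k≡N))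
  ... | no _ | no x≮N[1+p] =
    short-step-in-block 1≤k (m≤n⇒m≤1+n qk≤p) (≤-reflexive 2+p+k≡N) (≮⇒≥ x≮N[1+p]) (subst (λ m → x < N * m) N∸k≡2+p x<corner)
    where
    2+p+k≡N : suc (suc (p + k)) ≡ N
    2+p+k≡N = trans (sym (trans (+-suc p (suc k)) (cong suc (+-suc p k)))) p+2+k≡N
    N∸k≡2+p : N ∸ k ≡ suc (suc p)
    N∸k≡2+p = begin
      N ∸ k                 ≡⟨ cong (_∸ k) (sym p+2+k≡N) ⟩
      p + (2 + k) ∸ k       ≡⟨ cong (_∸ k) (sym (+-assoc p 2 k)) ⟩
      p + 2 + k ∸ k         ≡⟨ m+n∸n≡m (p + 2) k ⟩
      p + 2                 ≡⟨ +-comm p 2 ⟩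
      suc (suc p)           ∎
      where open ≡-Reasoning

-- The corner

-- (n - i)(n - j) = n² - n(i + j) + ij, with both sides moved so that no subtraction occurs.
complement-product : ∀ {n} a b i j → a + i ≡ n → b + j ≡ n → a * b + n * (i + j) ≡ n * n + i * j
complement-product {n} a b i j a+i≡n b+j≡n = begin
  a * b + n * (i + j)                  ≡⟨ cong (a * b +_) (*-distribˡ-+ n i j) ⟩
  a * b + (n * i + n * j)              ≡⟨ cong₂ (λ u w → a * b + (u * i + w * j)) (sym b+j≡n) (sym a+i≡n) ⟩
  a * b + ((b + j) * i + (a + i) * j)  ≡⟨ expand a b i j ⟩
  (a + i) * (b + j) + i * j            ≡⟨ cong₂ (λ u w → u * w + i * j) a+i≡n b+j≡n ⟩
  n * n + i * j                        ∎
  where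
  open ≡-Reasoning
  expand : ∀ a b i j → a * b + ((b + j) * i + (a + i) * j) ≡ (a + i) * (b + j) + i * j
  expand = solve-∀

-- Writing k = i + i′ = j + j′, one gets i = j′ + t, j = i′ + t and i j = k t + i′ j′.
*-excess-bound : ∀ {i j k t} → i ≤ k → j ≤ k → i + j ≡ k + t → i * j ≤ k * t + quarterSq k
*-excess-bound {i} {j} {k} {t} i≤k j≤k sum with m≤n⇒∃[o]m+o≡n i≤k | m≤n⇒∃[o]m+o≡n j≤k
... | i′ , refl | j′ , j+j′≡k = begin
  i * j                          ≡⟨ cong₂ _*_ i≡j′+t j≡i′+t ⟩
  (j′ + t) * (i′ + t)            ≡⟨ expand i′ j′ t ⟩
  (j′ + t + i′) * t + i′ * j′    ≡⟨ cong (λ m → m * t + i′ * j′) (cong (_+ i′) (sym i≡j′+t)) ⟩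
  (i + i′) * t + i′ * j′         ≤⟨ +-monoʳ-≤ ((i + i′) * t) (≤-trans (*≤quarterSq-+ i′ j′) (quarterSq-mono-≤ i′+j′≤k)) ⟩
  (i + i′) * t + quarterSq (i + i′) ∎
  where
  open ≤-Reasoning
  expand : ∀ i′ j′ t → (j′ + t) * (i′ + t) ≡ (j′ + t + i′) * t + i′ * j′
  expand = solve-∀
  j≡i′+t : j ≡ i′ + t
  j≡i′+t = +-cancelˡ-≡ i j (i′ + t) (trans sum (+-assoc i i′ t))
  i≡j′+t : i ≡ j′ + t
  i≡j′+t = +-cancelʳ-≡ i′ i (j′ + t) (begin-equality
    i + i′               ≡⟨ sym j+j′≡k ⟩
    j + j′               ≡⟨ cong (_+ j′) j≡i′+t ⟩
    i′ + t + j′          ≡⟨ rearrange i′ t j′ ⟩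
    j′ + t + i′          ∎)
    where
    rearrange : ∀ i′ t j′ → i′ + t + j′ ≡ j′ + t + i′
    rearrange = solve-∀
  i′+j′≤k : i′ + j′ ≤ i + i′
  i′+j′≤k = ≤-trans (+-monoʳ-≤ i′ (≤-trans (m≤m+n j′ t) (≤-reflexive (sym i≡j′+t)))) (≤-reflexive (+-comm i′ i))

module Corner {N k : ℕ} (below : quarterSq (2 + k) < N) where

  open ≤-Reasoning

  room : quarterSq k + (2 + k) ≤ N
  room = corner-room below

  k<N : k < N
  k<N = ≤-trans (≤-trans (n≤1+n (suc k)) (m≤n+m (2 + k) (quarterSq k))) room

  qk<N : quarterSq k < N
  qk<N = ≤-trans (s≤s (m≤m+n (quarterSq k) (suc k))) (≤-trans (≤-reflexive (sym (+-suc (quarterSq k) (suc k)))) room)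

  factor-in-corner : ∀ {c d i} → d ≤ N → N * (N ∸ k) ≤ c * d → c + i ≡ N → i ≤ k
  factor-in-corner {c} {d} {i} d≤N corner c+i≡N = +-cancelˡ-≤ (N ∸ k) i k (begin
    N ∸ k + i    ≤⟨ +-monoˡ-≤ i N∸k≤c ⟩
    c + i        ≡⟨ c+i≡N ⟩
    N            ≡⟨ sym (m∸n+n≡m (<⇒≤ k<N)) ⟩
    N ∸ k + k    ∎)
    where
    N∸k≤c : N ∸ k ≤ c
    N∸k≤c = ≮⇒≥ λ c<N∸k → <⇒≱ (begin-strict
      c * d        ≤⟨ *-monoʳ-≤ c d≤N ⟩
      c * N        <⟨ *-monoˡ-< N c<N∸k ⟩
      (N ∸ k) * N  ≡⟨ *-comm (N ∸ k) N ⟩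
      N * (N ∸ k)  ∎) corner
      where instance _ = >-nonZero (≤-trans (s≤s z≤n) k<N)

  -- The complementary factors i = N - c, j = N - d satisfy N (i + j - k) ≤ i j, which forces i + j ≤ k.
  deficits-in-corner : ∀ {c d i j} → c ≤ N → d ≤ N → N * (N ∸ k) ≤ c * d → c + i ≡ N → d + j ≡ N → i + j ≤ k
  deficits-in-corner {c} {d} {i} {j} c≤N d≤N corner c+i≡N d+j≡N = ≮⇒≥ λ k<i+j →
    let (t , k+1+t≡i+j) = m≤n⇒∃[o]m+o≡n k<i+j in <⇒≱ (excess-too-small t) (begin
      N * suc t                  ≤⟨ +-cancelˡ-≤ (N * k) _ _ (N*[i+j]≤ t k+1+t≡i+j) ⟩
      i * j                      ≤⟨ *-excess-bound i≤k j≤k (trans (sym k+1+t≡i+j) (sym (+-suc k t))) ⟩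
      k * suc t + quarterSq k    ∎)
    where
    i≤k : i ≤ k
    i≤k = factor-in-corner d≤N corner c+i≡N
    j≤k : j ≤ k
    j≤k = factor-in-corner c≤N (≤-trans corner (≤-reflexive (*-comm c d))) d+j≡N
    N*[i+j]≤ : ∀ t → suc k + t ≡ i + j → N * k + N * suc t ≤ N * k + i * j
    N*[i+j]≤ t k+1+t≡i+j = +-cancelˡ-≤ (N * (N ∸ k)) _ _ (begin
      N * (N ∸ k) + (N * k + N * suc t)  ≡⟨ cong (N * (N ∸ k) +_) (sym (*-distribˡ-+ N k (suc t))) ⟩
      N * (N ∸ k) + N * (k + suc t)      ≡⟨ cong (λ m → N * (N ∸ k) + N * m) (trans (+-suc k t) k+1+t≡i+j) ⟩
      N * (N ∸ k) + N * (i + j)          ≤⟨ +-monoˡ-≤ (N * (i + j)) corner ⟩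
      c * d + N * (i + j)                ≡⟨ complement-product c d i j c+i≡N d+j≡N ⟩
      N * N + i * j                      ≡⟨ cong (_+ i * j) (sym (trans (sym (*-distribˡ-+ N (N ∸ k) k)) (cong (N *_) (m∸n+n≡m (<⇒≤ k<N))))) ⟩
      N * (N ∸ k) + N * k + i * j        ≡⟨ +-assoc (N * (N ∸ k)) (N * k) (i * j) ⟩
      N * (N ∸ k) + (N * k + i * j)      ∎)
    excess-too-small : ∀ t → k * suc t + quarterSq k < N * suc t
    excess-too-small t = begin-strict
      k * suc t + quarterSq k                  <⟨ m<m+n _ (s≤s z≤n) ⟩
      k * suc t + quarterSq k + suc (quarterSq k * t + 2 * t + 1) ≡⟨ expand k (quarterSq k) t ⟩
      (quarterSq k + (2 + k)) * suc t          ≤⟨ *-monoˡ-≤ (suc t) room ⟩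
      N * suc t                                ∎
      where
      expand : ∀ k q t → k * suc t + q + suc (q * t + 2 * t + 1) ≡ (q + (2 + k)) * suc t
      expand = solve-∀

  -- The large gaps of the corner run from gapStart s = (N - ⌊s/2⌋)(N - ⌈s/2⌉) up to the row entry gapEnd s = N (N - s + 1).
  gapStart gapEnd : ℕ → ℕ
  gapStart s = N * (N ∸ s) + quarterSq s
  gapEnd s = N * suc (N ∸ s)

  N*[N∸s]+N*s : ∀ {s} → s ≤ N → N * (N ∸ s) + N * s ≡ N * N
  N*[N∸s]+N*s {s} s≤N = trans (sym (*-distribˡ-+ N (N ∸ s) s)) (cong (N *_) (m∸n+n≡m s≤N))

  gapStart+N*s : ∀ {s} → s ≤ N → gapStart s + N * s ≡ N * N + quarterSq s
  gapStart+N*s {s} s≤N = begin-equality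
    N * (N ∸ s) + quarterSq s + N * s   ≡⟨ +-assoc (N * (N ∸ s)) (quarterSq s) (N * s) ⟩
    N * (N ∸ s) + (quarterSq s + N * s) ≡⟨ cong (N * (N ∸ s) +_) (+-comm (quarterSq s) (N * s)) ⟩
    N * (N ∸ s) + (N * s + quarterSq s) ≡⟨ sym (+-assoc (N * (N ∸ s)) (N * s) (quarterSq s)) ⟩
    N * (N ∸ s) + N * s + quarterSq s   ≡⟨ cong (_+ quarterSq s) (N*[N∸s]+N*s s≤N) ⟩
    N * N + quarterSq s                 ∎

  gapEnd+N*s : ∀ {s} → s ≤ N → gapEnd s + N * s ≡ N * N + N
  gapEnd+N*s {s} s≤N = begin-equality
    N * suc (N ∸ s) + N * s      ≡⟨ cong (_+ N * s) (*-suc N (N ∸ s)) ⟩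
    N + N * (N ∸ s) + N * s      ≡⟨ +-assoc N (N * (N ∸ s)) (N * s) ⟩
    N + (N * (N ∸ s) + N * s)    ≡⟨ cong (N +_) (N*[N∸s]+N*s s≤N) ⟩
    N + N * N                    ≡⟨ +-comm N (N * N) ⟩
    N * N + N                    ∎

  gapEnd∸gapStart : ∀ s → gapEnd s ∸ gapStart s ≡ N ∸ quarterSq s
  gapEnd∸gapStart s = trans (cong (_∸ gapStart s) (trans (*-suc N (N ∸ s)) (+-comm N (N * (N ∸ s)))))
                            ([m+n]∸[m+o]≡n∸o (N * (N ∸ s)) N (quarterSq s))

  gapStart<gapEnd : ∀ {s} → s ≤ k → gapStart s < gapEnd s
  gapStart<gapEnd {s} s≤k = begin-strict
    N * (N ∸ s) + quarterSq s   <⟨ +-monoʳ-< (N * (N ∸ s)) (≤-<-trans (quarterSq-mono-≤ s≤k) qk<N) ⟩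
    N * (N ∸ s) + N             ≡⟨ +-comm (N * (N ∸ s)) N ⟩
    N + N * (N ∸ s)             ≡⟨ sym (*-suc N (N ∸ s)) ⟩
    N * suc (N ∸ s)             ∎

  gapEnd∈table : ∀ {s} → 1 ≤ s → s ≤ N → gapEnd s ∈ table N
  gapEnd∈table {suc s} _ s≤N = ∈-table⁺ (≤-trans (s≤s z≤n) s≤N) ≤-refl (s≤s z≤n)
    (≤-trans (≤-reflexive (sym (+-∸-assoc 1 s≤N))) (m∸n≤m N s))

  gapStart∈table : ∀ {s} → s ≤ k → gapStart s ∈ table N
  gapStart∈table {s} s≤k = subst (_∈ table N) product≡gapStart
    (∈-table⁺ (m<n⇒0<n∸m ⌊s/2⌋<N) (m∸n≤m N ⌊ s /2⌋) (m<n⇒0<n∸m ⌈s/2⌉<N) (m∸n≤m N ⌈ s /2⌉))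
    where
    ⌈s/2⌉<N : ⌈ s /2⌉ < N
    ⌈s/2⌉<N = ≤-<-trans (⌈n/2⌉≤n s) (≤-<-trans s≤k k<N)
    ⌊s/2⌋<N : ⌊ s /2⌋ < N
    ⌊s/2⌋<N = ≤-<-trans (⌊n/2⌋≤⌈n/2⌉ s) ⌈s/2⌉<N
    product≡gapStart : (N ∸ ⌊ s /2⌋) * (N ∸ ⌈ s /2⌉) ≡ gapStart s
    product≡gapStart = +-cancelʳ-≡ (N * s) _ _ (begin-equality
      (N ∸ ⌊ s /2⌋) * (N ∸ ⌈ s /2⌉) + N * s                     ≡⟨ cong (λ m → (N ∸ ⌊ s /2⌋) * (N ∸ ⌈ s /2⌉) + N * m) (sym (⌊n/2⌋+⌈n/2⌉≡n s)) ⟩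
      (N ∸ ⌊ s /2⌋) * (N ∸ ⌈ s /2⌉) + N * (⌊ s /2⌋ + ⌈ s /2⌉)   ≡⟨ complement-product _ _ ⌊ s /2⌋ ⌈ s /2⌉ (m∸n+n≡m (<⇒≤ ⌊s/2⌋<N)) (m∸n+n≡m (<⇒≤ ⌈s/2⌉<N)) ⟩
      N * N + ⌊ s /2⌋ * ⌈ s /2⌉                                 ≡⟨ cong (N * N +_) (⌊n/2⌋*⌈n/2⌉≡quarterSq s) ⟩
      N * N + quarterSq s                                       ≡⟨ sym (gapStart+N*s (<⇒≤ (≤-<-trans s≤k k<N))) ⟩
      gapStart s + N * s                                        ∎)

  nothing-between : ∀ {s z} → s ≤ k → z ∈ table N → gapStart s < z → gapEnd s ≤ z
  nothing-between {s} {z} s≤k z∈ start<z with ∈-table⁻ {N} z∈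
  ... | factorisation c d c≤N d≤N refl = between c d (N ∸ c) (N ∸ d) (m+[n∸m]≡n c≤N) (m+[n∸m]≡n d≤N) start<z
    where
    s≤N : s ≤ N
    s≤N = <⇒≤ (≤-<-trans s≤k k<N)
    between : ∀ c d i j → c + i ≡ N → d + j ≡ N → gapStart s < c * d → gapEnd s ≤ c * d
    between c d i j c+i≡N d+j≡N start<cd with i + j <? s
    ... | yes i+j<s with m≤n⇒∃[o]m+o≡n i+j<s
    ...   | t , refl = +-cancelʳ-≤ (N * (i + j)) (gapEnd s) (c * d) (begin
      gapEnd s + N * (i + j)              ≤⟨ m≤m+n _ (N * t) ⟩
      gapEnd s + N * (i + j) + N * t      ≡⟨ +-cancelʳ-≡ N _ _ (trans (rearrange (gapEnd s) N (i + j) t) (gapEnd+N*s s≤N)) ⟩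
      N * N                               ≤⟨ m≤m+n (N * N) (i * j) ⟩
      N * N + i * j                       ≡⟨ sym (complement-product c d i j c+i≡N d+j≡N) ⟩
      c * d + N * (i + j)                 ∎)
      where
      rearrange : ∀ g N s′ t → g + N * s′ + N * t + N ≡ g + N * suc (s′ + t)
      rearrange = solve-∀
    between c d i j c+i≡N d+j≡N start<cd | no i+j≮s with m≤n⇒∃[o]m+o≡n (≮⇒≥ i+j≮s)
    ... | t , s+t≡i+j = ⊥-elim (<⇒≱ start<cd (+-cancelʳ-≤ (N * (i + j)) (c * d) (gapStart s) (begin
      c * d + N * (i + j)                 ≡⟨ complement-product c d i j c+i≡N d+j≡N ⟩
      N * N + i * j                       ≤⟨ +-monoʳ-≤ (N * N) (*≤quarterSq-+ i j) ⟩
      N * N + quarterSq (i + j)           ≤⟨ +-monoʳ-≤ (N * N) (quarterSq-≤-+N* t s+t≡i+j) ⟩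
      N * N + (quarterSq s + N * t)       ≡⟨ sym (+-assoc (N * N) (quarterSq s) (N * t)) ⟩
      N * N + quarterSq s + N * t         ≡⟨ cong (_+ N * t) (sym (gapStart+N*s s≤N)) ⟩
      gapStart s + N * s + N * t          ≡⟨ +-assoc (gapStart s) (N * s) (N * t) ⟩
      gapStart s + (N * s + N * t)        ≡⟨ cong (gapStart s +_) (trans (sym (*-distribˡ-+ N s t)) (cong (N *_) s+t≡i+j)) ⟩
      gapStart s + N * (i + j)            ∎)))
      where
      i+j≤k : i + j ≤ k
      i+j≤k = deficits-in-corner (≤-trans (m≤m+n c i) (≤-reflexive c+i≡N)) (≤-trans (m≤m+n d j) (≤-reflexive d+j≡N))
        (≤-trans (*-monoʳ-≤ N (∸-monoʳ-≤ N s≤k)) (≤-trans (m≤m+n _ (quarterSq s)) (<⇒≤ start<cd)))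
        c+i≡N d+j≡N
      quarterSq-≤-+N* : ∀ t → s + t ≡ i + j → quarterSq (i + j) ≤ quarterSq s + N * t
      quarterSq-≤-+N* zero s+0≡i+j = ≤-trans (≤-reflexive (cong quarterSq (trans (sym s+0≡i+j) (+-identityʳ s)))) (m≤m+n _ _)
      quarterSq-≤-+N* (suc t) _ = ≤-trans (<⇒≤ (≤-<-trans (quarterSq-mono-≤ i+j≤k) qk<N))
        (≤-trans (m≤m*n N (suc t)) (m≤n+m _ (quarterSq s)))

  gap-pair-consecutive : ∀ {s} → 1 ≤ s → s ≤ k → (gapStart s , gapEnd s) ∈ consecutive (table N)
  gap-pair-consecutive 1≤s s≤k = consecutive-intro (table-sorted N) (gapStart∈table s≤k)
    (gapEnd∈table 1≤s (<⇒≤ (≤-<-trans s≤k k<N))) (gapStart<gapEnd s≤k) (nothing-between s≤k)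

  LargeGap : ℕ → ℕ → Set
  LargeGap x y = ∃[ s ] (1 ≤ s × s ≤ k × x ≡ gapStart s × y ≡ gapEnd s)

  consecutive-at-level : ∀ {x y s} → (x , y) ∈ consecutive (table N) → x < y → s ≤ k →
    x + N * s ≡ N * N + quarterSq s → LargeGap x y
  consecutive-at-level {x} {y} {zero} xy∈ x<y _ x+0≡N*N =
    ⊥-elim (<⇒≱ x<y (≤-trans (table-≤ {N} (consecutive-∈ʳ xy∈)) (≤-reflexive x≡N*N)))
    where
    x≡N*N : N * N ≡ x
    x≡N*N = sym (+-cancelʳ-≡ (N * 0) x (N * N) (trans x+0≡N*N (cong (N * N +_) (sym (*-zeroʳ N)))))
  consecutive-at-level {x} {y} {s@(suc _)} xy∈ x<y s≤k x+Ns≡ = s , s≤s z≤n , s≤k , x≡start , y≡end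
    where
    x≡start : x ≡ gapStart s
    x≡start = +-cancelʳ-≡ (N * s) x (gapStart s) (trans x+Ns≡ (sym (gapStart+N*s (<⇒≤ (≤-<-trans s≤k k<N)))))
    y≡end : y ≡ gapEnd s
    y≡end = ≤-antisym
      (consecutive-next (table-sorted N) xy∈ (gapEnd∈table (s≤s z≤n) (<⇒≤ (≤-<-trans s≤k k<N)))
        (subst (_< gapEnd s) (sym x≡start) (gapStart<gapEnd s≤k)))
      (nothing-between s≤k (consecutive-∈ʳ xy∈) (subst (_< y) x≡start x<y))

  consecutive-factored : ∀ {x y c d} → (x , y) ∈ consecutive (table N) → N * (N ∸ k) ≤ x → x < y →
    c ≤ d → d ≤ N → x ≡ c * d → y ∸ x + 1 ≤ k ⊎ LargeGap x y
  consecutive-factored {x} {y} {c} {d} xy∈ corner x<y c≤d d≤N x≡cd with d ≤? suc c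
  ... | yes d≤1+c = inj₂ (consecutive-at-level xy∈ x<y s≤k (begin-equality
    x + N * (i + j)            ≡⟨ cong (_+ N * (i + j)) x≡cd ⟩
    c * d + N * (i + j)        ≡⟨ complement-product c d i j c+i≡N d+j≡N ⟩
    N * N + i * j              ≡⟨ cong (N * N +_) (trans (*-comm i j) (*≡quarterSq-+ j≤i i≤1+j)) ⟩
    N * N + quarterSq (j + i)  ≡⟨ cong (λ m → N * N + quarterSq m) (+-comm j i) ⟩
    N * N + quarterSq (i + j)  ∎))
    where
    i j : ℕ
    i = N ∸ c
    j = N ∸ d
    c+i≡N : c + i ≡ N
    c+i≡N = m+[n∸m]≡n (≤-trans c≤d d≤N)
    d+j≡N : d + j ≡ N
    d+j≡N = m+[n∸m]≡n d≤N
    s≤k : i + j ≤ k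
    s≤k = deficits-in-corner (≤-trans c≤d d≤N) d≤N (≤-trans corner (≤-reflexive x≡cd)) c+i≡N d+j≡N
    j≤i : j ≤ i
    j≤i = ∸-monoʳ-≤ N c≤d
    i≤1+j : i ≤ suc j
    i≤1+j = +-cancelˡ-≤ d i (suc j) (begin
      d + i        ≤⟨ +-monoˡ-≤ i d≤1+c ⟩
      suc c + i    ≡⟨ cong suc (trans c+i≡N (sym d+j≡N)) ⟩
      suc (d + j)  ≡⟨ sym (+-suc d j) ⟩
      d + suc j    ∎)
  ... | no d≰1+c with m≤n⇒∃[o]m+o≡n (≰⇒> d≰1+c)
  ...   | e , refl = inj₁ (begin
    y ∸ x + 1         ≤⟨ +-monoˡ-≤ 1 (m≤n+o⇒m∸n≤o y x y≤x+1+e) ⟩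
    suc e + 1         ≡⟨ +-comm (suc e) 1 ⟩
    2 + e             ≤⟨ +-cancelˡ-≤ c (2 + e) (N ∸ c) (≤-trans (≤-reflexive (shift c e)) (≤-trans d≤N (≤-reflexive (sym (m+[n∸m]≡n c≤N))))) ⟩
    N ∸ c             ≤⟨ factor-in-corner d≤N (≤-trans corner (≤-reflexive x≡cd)) (m+[n∸m]≡n c≤N) ⟩
    k                 ∎)
    where
    c≤N : c ≤ N
    c≤N = ≤-trans c≤d d≤N
    shift : ∀ c e → c + (2 + e) ≡ 2 + c + e
    shift = solve-∀
    next : c * (2 + c + e) + suc e ≡ suc c * suc (c + e)
    next = step c e
      where
      step : ∀ c e → c * (2 + c + e) + suc e ≡ suc c * suc (c + e)
      step = solve-∀
    x+1+e≡ : x + suc e ≡ suc c * suc (c + e)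
    x+1+e≡ = trans (cong (_+ suc e) x≡cd) next
    y≤x+1+e : y ≤ x + suc e
    y≤x+1+e = subst (y ≤_) (sym x+1+e≡) (consecutive-next (table-sorted N) xy∈
      (∈-table⁺ (s≤s z≤n) (≤-trans (s≤s (≤-trans (m≤m+n c e) (n≤1+n _))) d≤N) (s≤s z≤n) (≤-trans (n≤1+n _) d≤N))
      (subst (x <_) x+1+e≡ (m<m+n x (s≤s z≤n))))

  consecutive-in-corner : ∀ {x y} → (x , y) ∈ consecutive (table N) → N * (N ∸ k) ≤ x → x < y →
    y ∸ x + 1 ≤ k ⊎ LargeGap x y
  consecutive-in-corner {x} {y} xy∈ corner x<y with ∈-table⁻ {N} (consecutive-∈ˡ xy∈)
  ... | factorisation c d c≤N d≤N x≡cd with ≤-total c d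
  ...   | inj₁ c≤d = consecutive-factored xy∈ corner x<y c≤d d≤N x≡cd
  ...   | inj₂ d≤c = consecutive-factored xy∈ corner x<y d≤c c≤N (trans x≡cd (*-comm c d))

  2+k≤large-gap : ∀ {s} → s ≤ k → 2 + k ≤ N ∸ quarterSq s
  2+k≤large-gap s≤k = ≤-trans (m+n≤o⇒m≤o∸n (2 + k) (≤-trans (≤-reflexive (+-comm (2 + k) (quarterSq k))) room))
                              (∸-monoʳ-≤ N (quarterSq-mono-≤ s≤k))

  gap-classification : ∀ {x y} → 1 ≤ k → (x , y) ∈ consecutive (table N) → N * (N ∸ k) ≤ x →
    y ∸ x + 3 ≤ 2 + k ⊎ InB N (2 + k) (y ∸ x)
  gap-classification {x} {y} 1≤k xy∈ corner with m≤n⇒m<n∨m≡n (consecutive-≤ (table-sorted N) xy∈)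
  ... | inj₂ refl = inj₁ (≤-trans (≤-reflexive (cong (_+ 3) (n∸n≡0 x))) (s≤s (s≤s 1≤k)))
  ... | inj₁ x<y with consecutive-in-corner xy∈ corner x<y
  ...   | inj₁ small = inj₁ (≤-trans (≤-reflexive (+-comm (y ∸ x) 3)) (s≤s (s≤s (≤-trans (≤-reflexive (+-comm 1 (y ∸ x))) small))))
  ...   | inj₂ (s , 1≤s , s≤k , refl , refl) = inj₂ (s , 1≤s , s≤k , gapEnd∸gapStart s)

  large-gap-isolated : 1 ≤ k → N ≤ quarterSq (3 + k) → ∀ {s} → 1 ≤ s → s ≤ k → Isolated N (N ∸ quarterSq s)
  large-gap-isolated 1≤k above {s} 1≤s s≤k = subst (Isolated N) (gapEnd∸gapStart s)
    (count-unique (table-sorted N) (gap-pair-consecutive 1≤s s≤k) (gapStart<gapEnd s≤k) unique)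
    where
    large : 2 + k ≤ gapEnd s ∸ gapStart s
    large = ≤-trans (2+k≤large-gap s≤k) (≤-reflexive (sym (gapEnd∸gapStart s)))
    unique : ∀ {x′ y′} → (x′ , y′) ∈ consecutive (table N) → y′ ∸ x′ ≡ gapEnd s ∸ gapStart s → x′ ≡ gapStart s
    unique {x′} {y′} xy∈ same with x′ <? N * (N ∸ k)
    ... | yes below-corner with short-step-below-corner 1≤k below above below-corner
    ...   | z , z∈ , x′<z , z+qk<x′+N = ⊥-elim (<⇒≱ z+qk<x′+N (begin
      x′ + N                                    ≡⟨ cong (x′ +_) (sym (m∸n+n≡m (<⇒≤ qk<N))) ⟩
      x′ + (N ∸ quarterSq k + quarterSq k)      ≤⟨ +-monoʳ-≤ x′ (+-monoˡ-≤ (quarterSq k)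
                                                     (≤-trans (∸-monoʳ-≤ N (quarterSq-mono-≤ s≤k))
                                                              (≤-reflexive (sym (trans same (gapEnd∸gapStart s)))))) ⟩
      x′ + (y′ ∸ x′ + quarterSq k)              ≡⟨ sym (+-assoc x′ (y′ ∸ x′) (quarterSq k)) ⟩
      x′ + (y′ ∸ x′) + quarterSq k              ≡⟨ cong (_+ quarterSq k) (m+[n∸m]≡n (consecutive-≤ (table-sorted N) xy∈)) ⟩
      y′ + quarterSq k                          ≤⟨ +-monoˡ-≤ (quarterSq k) (consecutive-next (table-sorted N) xy∈ z∈ x′<z) ⟩
      z + quarterSq k                           ∎))
    unique {x′} {y′} xy∈ same | no x′≮corner with m≤n⇒m<n∨m≡n (consecutive-≤ (table-sorted N) xy∈)
    ... | inj₂ refl = ⊥-elim (<⇒≱ (≤-trans (s≤s z≤n) large) (≤-reflexive (trans (sym same) (n∸n≡0 x′))))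
    ... | inj₁ x′<y′ with consecutive-in-corner xy∈ (≮⇒≥ x′≮corner) x′<y′
    ...   | inj₁ small = ⊥-elim (<⇒≱ (≤-trans (≤-reflexive (+-comm 1 (y′ ∸ x′))) (≤-trans small (m≤n+m k 2)))
                                    (≤-trans large (≤-reflexive (sym same))))
    ...   | inj₂ (s′ , 1≤s′ , s′≤k , refl , refl) = cong gapStart (quarterSq-injective 1≤s′ 1≤s
      (∸-cancelˡ-≡ (≤-trans (quarterSq-mono-≤ s′≤k) (<⇒≤ qk<N)) (≤-trans (quarterSq-mono-≤ s≤k) (<⇒≤ qk<N))
        (trans (sym (gapEnd∸gapStart s′)) (trans same (gapEnd∸gapStart s)))))

-- For N = 2 we have R = 2, so the corner is {4}, the last entry of the table.
no-pair-in-corner-of-2 : ∀ {x y} → (x , y) ∈ consecutive (table 2) → 4 ≤ x → ⊥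
no-pair-in-corner-of-2 (here refl) (s≤s ())
no-pair-in-corner-of-2 (there (here refl)) (s≤s (s≤s ()))
no-pair-in-corner-of-2 (there (there (here refl))) (s≤s (s≤s ()))

corollary4p5 : (N R : ℕ) → 2 ≤ N → IsLargestR N R →
    (x y : ℕ) → (x , y) ∈ consecutive (table N) →
    N * (N ∸ (R ∸ 2)) ≤ x → y ≤ N * N →
    (((y ∸ x) + 3 ≤ R) ⊎ InB N R (y ∸ x))
    × (InB N R (y ∸ x) → Isolated N (y ∸ x))
corollary4p5 (suc (suc zero)) R _ (qR<2 , _) x y xy∈ corner _ =
  ⊥-elim (no-pair-in-corner-of-2 xy∈ (subst (λ r → 2 * (2 ∸ r) ≤ x) (m≤n⇒m∸n≡0 R≤2) corner))
  where
  R≤2 : R ≤ 2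
  R≤2 = ≤-pred (quarterSq-cancel-< {R} {3} qR<2)
corollary4p5 N@(suc (suc (suc _))) R _ (below , maximal) x y xy∈ corner _ with maximal 3 (s≤s (s≤s (s≤s z≤n)))
... | s≤s (s≤s {n = k} 1≤k) = gap-classification 1≤k xy∈ corner ,
  λ { (s , 1≤s , s≤k , g≡) → subst (Isolated N) (sym g≡) (large-gap-isolated 1≤k above 1≤s s≤k) }
  where
  open Corner {N} {k} below
  above : N ≤ quarterSq (3 + k)
  above = ≮⇒≥ λ q<N → <-irrefl refl (maximal (3 + k) q<N)
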